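{- Let $\alpha\geq 2$ be an integer and $\Gamma=\mathbb{Z}_{2}\oplus \mathbb{Z}_{2^{2\alpha-1}}$. Then there exists a $\Gamma$-magic square $\mathrm{MS}_{\Gamma}(2^\alpha)$ of side $2^\alpha$.
   Context: For an Abelian group $(\Gamma,+)$ of order $n^2$, a $\Gamma$-magic square $\mathrm{MS}_{\Gamma}(n)$ (of side $n$) is an $n\times n$ array whose entries are all the elements of $\Gamma$ (each element appearing exactly once) such that all row sums, all column sums, the sum along the main diagonal and the sum along the backward main diagonal are equal to the same element $\mu\in\Gamma$. $\mathbb{Z}_r$ denotes the cyclic group of order $r$. -}

module Defs where

open import Data.Nat using (ℕ; zero; suc; _∸_; _^_; NonZero)
import Data.Nat as ℕ
open import Data.Nat.DivMod using (_%_)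
import Data.Fin
open Data.Fin using (Fin; toℕ; fromℕ<)
import Data.Nat.Properties as P
open import Data.Nat.DivMod using (m%n<n)
import Data.Product
open Data.Product using (_×_; _,_; Σ)
open import Function.Definitions using (Bijective)
open import Relation.Binary.PropositionalEquality using (_≡_)

_+ₘ_ : ∀ {m} .{{_ : NonZero m}} → Fin m → Fin m → Fin m
_+ₘ_ {m} a b = fromℕ< (m%n<n (toℕ a ℕ.+ toℕ b) m)

Γ : ℕ → Set
Γ α = Fin 2 × Fin (2 ^ (2 ℕ.* α ∸ 1))

pow2-nz : ∀ k → NonZero (2 ^ k)
pow2-nz zero = _
pow2-nz (suc k) = ℕ.>-nonZero (P.m^n>0 2 (suc k))


add : ∀ α → Γ α → Γ α → Γ α
add α (a , b) (c , d) = (a +ₘ c) , (_+ₘ_ {{pow2-nz (2 ℕ.* α ∸ 1)}} b d)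

0Γ : ∀ α → Γ α
0Γ α = Data.Fin.zero , fromℕ< (P.m^n>0 2 (2 ℕ.* α ∸ 1))


ΣΓ : ∀ α n → (Fin n → Γ α) → Γ α
ΣΓ α zero f = 0Γ α
ΣΓ α (suc n) f = add α (f Data.Fin.zero) (ΣΓ α n (λ i → f (Data.Fin.suc i)))


rev : ∀ {n} → Fin n → Fin n
rev = Data.Fin.opposite


record MagicSquare (α n : ℕ) : Set where
  field
    A      : Fin n → Fin n → Γ α
    bij    : Bijective _≡_ _≡_ (λ (p : Fin n × Fin n) → A (Data.Product.proj₁ p) (Data.Product.proj₂ p))
    μ      : Γ α
    rows   : ∀ i → ΣΓ α n (λ j → A i j) ≡ μ
    cols   : ∀ j → ΣΓ α n (λ i → A i j) ≡ μ
    diag   : ΣΓ α n (λ i → A i i) ≡ μ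
    antidiag : ΣΓ α n (λ i → A i (rev i)) ≡ μ

module Submission where

open import Defs
open import Data.Nat using (ℕ; zero; suc; _+_; _*_; _∸_; _^_; _<_; _≤_; _≥_; s≤s; NonZero)
open import Data.Nat.Properties
open import Data.Nat.DivMod using (_%_; %-distribˡ-+; m%n%n≡m%n; [m+kn]%n≡m%n; m<n⇒m%n≡m; m*n%n≡0)
open import Data.Nat.Tactic.RingSolver using (solve; solve-∀)
open import Data.Fin as Fin using (Fin; toℕ; fromℕ<; combine; opposite; cast; _↑ˡ_; _↑ʳ_)
open import Data.Fin.Patterns using (0F; 1F)
open import Data.Fin.Properties
  using (toℕ-injective; toℕ-fromℕ<; toℕ-cast; toℕ-combine; toℕ<n; opposite-prop; opposite-involutive;
         cast-involutive; remQuot-combine; combine-remQuot; *↔×)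
open import Data.Fin.Permutation using (permutation)
open import Data.List using (_∷_; [])
open import Data.Product using (_×_; _,_; proj₁; proj₂)
open import Data.Product.Function.NonDependent.Propositional using (_×-↔_)
open import Algebra.Properties.Semiring.Sum +-*-semiring
  using (sum; sum-syntax; sum-cong-≗; ∑-distrib-+; ∑-permute; *-distribˡ-sum)
open import Function using (id; _∘_; _↔_; Inverse; mk↔ₛ′)
open import Function.Bundles using (Bijection)
open import Function.Construct.Identity using (↔-id)
open import Function.Construct.Symmetry using (↔-sym)
open import Function.Construct.Composition using (_↔-∘_)
open import Function.Properties.Inverse using (↔⇒⤖)
open import Relation.Binary.PropositionalEquality
open import Relation.Nullary using (contradiction)
open ≡-Reasoning

-- Let m = 2^(α-1) and M = m², so that Γ = ℤ₂ ⊕ ℤ_{2M} and the side is 2m.  Index rows and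
-- columns by pairs (s , p), (t , q) ∈ ℤ₂ × [0, m) and place
--     (s , M t + m φ(p) + φ(q))
-- at ((s , p), (t , q)), where φ is the identity if s = t and the reflection x ↦ m - 1 - x
-- otherwise; φ is an involution, so this is a bijection onto Γ.  Split every line into m pairs
-- of cells, one in each half.  In a row or a column the two cells of a pair have complementary
-- base-m digits, so their second coordinates add up to M (t + t′) + M - 1; on the two diagonals
-- the sum reduces to Gauss's 2 (0 + ⋯ + (m-1)) + m = m².  As m is even, every line sums to
-- (0 , -m).

∑-const : ∀ n c → ∑[ i < n ] c ≡ n * c
∑-const zero    c = refl
∑-const (suc n) c = cong (c +_) (∑-const n c)

∑-suc : ∀ n (f : Fin n → ℕ) → ∑[ i < n ] suc (f i) ≡ sum f + n
∑-suc zero    f = refl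
∑-suc (suc n) f =
  trans (cong suc (trans (cong (f 0F +_) (∑-suc n (f ∘ Fin.suc))) (sym (+-assoc (f 0F) _ n))))
        (sym (+-suc _ n))

∑+n≡n*c : ∀ n (f : Fin n → ℕ) c → (∀ i → suc (f i) ≡ c) → sum f + n ≡ n * c
∑+n≡n*c n f c eq = trans (sym (∑-suc n f)) (trans (sum-cong-≗ eq) (∑-const n c))

∑-↑ : ∀ m n (f : Fin (m + n) → ℕ) → sum f ≡ ∑[ i < m ] f (i ↑ˡ n) + ∑[ j < n ] f (m ↑ʳ j)
∑-↑ zero    n f = refl
∑-↑ (suc m) n f = trans (cong (f 0F +_) (∑-↑ m n (f ∘ Fin.suc))) (sym (+-assoc (f 0F) _ _))

∑-combine : ∀ m n (f : Fin (m * n) → ℕ) → sum f ≡ ∑[ i < m ] ∑[ j < n ] f (combine i j)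
∑-combine zero    n f = refl
∑-combine (suc m) n f =
  trans (∑-↑ n (m * n) f) (cong (∑[ j < n ] f (j ↑ˡ m * n) +_) (∑-combine m n (λ k → f (n ↑ʳ k))))

halves : ∀ m → (Fin (2 * m) → ℕ) → Fin m → ℕ
halves m f p = f (combine {2} 0F p) + f (combine {2} 1F p)

∑-halves : ∀ m (f : Fin (2 * m) → ℕ) → sum f ≡ sum (halves m f)
∑-halves m f = begin
  sum f                    ≡⟨ ∑-combine 2 m f ⟩
  sum f₀ + (sum f₁ + 0)    ≡⟨ cong (sum f₀ +_) (+-identityʳ (sum f₁)) ⟩
  sum f₀ + sum f₁          ≡⟨ ∑-distrib-+ f₀ f₁ ⟨
  sum (halves m f)         ∎
  where
  f₀ f₁ : Fin m → ℕ
  f₀ = f ∘ combine {2} 0F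
  f₁ = f ∘ combine {2} 1F

∑-opposite : ∀ n (f : Fin n → ℕ) → ∑[ i < n ] f (opposite i) ≡ sum f
∑-opposite n f = sym (∑-permute f (permutation opposite opposite opposite-involutive opposite-involutive))

toℕ+toℕ-opposite : ∀ {n} (i : Fin n) → suc (toℕ i + toℕ (opposite i)) ≡ n
toℕ+toℕ-opposite i = trans (cong (λ k → suc (toℕ i + k)) (opposite-prop i)) (m+[n∸m]≡n (toℕ<n i))

complement⇒opposite : ∀ {n} (i j : Fin n) → suc (toℕ i + toℕ j) ≡ n → j ≡ opposite i
complement⇒opposite {n} i j eq = toℕ-injective (begin
  toℕ j                              ≡⟨ m+n∸m≡n (suc (toℕ i)) (toℕ j) ⟨
  suc (toℕ i + toℕ j) ∸ suc (toℕ i)  ≡⟨ cong (_∸ suc (toℕ i)) eq ⟩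
  n ∸ suc (toℕ i)                    ≡⟨ opposite-prop i ⟨
  toℕ (opposite i)                   ∎)

∑-toℕ : ∀ n → 2 * ∑[ i < n ] toℕ i + n ≡ n * n
∑-toℕ n = begin
  2 * T + n                                  ≡⟨ cong (λ x → T + x + n) (trans (+-identityʳ T) (sym (∑-opposite n toℕ))) ⟩
  T + ∑[ i < n ] toℕ (opposite i) + n        ≡⟨ cong (_+ n) (∑-distrib-+ {n} toℕ (toℕ ∘ opposite)) ⟨
  ∑[ i < n ] (toℕ i + toℕ (opposite i)) + n  ≡⟨ ∑+n≡n*c n _ n toℕ+toℕ-opposite ⟩
  n * n                                      ∎
  where T = ∑[ i < n ] toℕ i

diagonal-sum : ∀ n (σ : Fin n → Fin n) → ∑[ p < n ] toℕ (σ p) ≡ ∑[ p < n ] toℕ p →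
               ∑[ p < n ] (n * n + 2 * (n * toℕ (σ p) + toℕ p)) + n ≡ n * (2 * (n * n))
diagonal-sum n σ ∑σ≡∑ = begin
  ∑[ p < n ] (n * n + 2 * (n * toℕ (σ p) + toℕ p)) + n
    ≡⟨ cong (_+ n) (∑-distrib-+ {n} (λ _ → n * n) _) ⟩
  ∑[ p < n ] (n * n) + ∑[ p < n ] (2 * (n * toℕ (σ p) + toℕ p)) + n
    ≡⟨ cong (λ x → x + n) (cong₂ _+_ (∑-const n (n * n)) (sym (*-distribˡ-sum {n} 2 _))) ⟩
  n * (n * n) + 2 * ∑[ p < n ] (n * toℕ (σ p) + toℕ p) + n
    ≡⟨ cong (λ x → n * (n * n) + 2 * x + n) (∑-distrib-+ {n} (λ p → n * toℕ (σ p)) toℕ) ⟩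
  n * (n * n) + 2 * (∑[ p < n ] (n * toℕ (σ p)) + T) + n
    ≡⟨ cong (λ x → n * (n * n) + 2 * (x + T) + n) (sym (*-distribˡ-sum {n} n _)) ⟩
  n * (n * n) + 2 * (n * ∑[ p < n ] toℕ (σ p) + T) + n
    ≡⟨ cong (λ x → n * (n * n) + 2 * (n * x + T) + n) ∑σ≡∑ ⟩
  n * (n * n) + 2 * (n * T + T) + n
    ≡⟨ regroup n T ⟩
  n * (n * n) + (n * (2 * T) + (2 * T + n))
    ≡⟨ cong (λ x → n * (n * n) + (n * (2 * T) + x)) (∑-toℕ n) ⟩
  n * (n * n) + (n * (2 * T) + n * n)
    ≡⟨ cong (n * (n * n) +_) (*-distribˡ-+ n (2 * T) n) ⟨
  n * (n * n) + n * (2 * T + n)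
    ≡⟨ cong (λ x → n * (n * n) + n * x) (∑-toℕ n) ⟩
  n * (n * n) + n * (n * n)
    ≡⟨ solve (n ∷ []) ⟩
  n * (2 * (n * n))
    ∎
  where
  T = ∑[ p < n ] toℕ p
  regroup : ∀ a c → a * (a * a) + 2 * (a * c + c) + a ≡ a * (a * a) + (a * (2 * c) + (2 * c + a))
  regroup = solve-∀

complement-digits : ∀ {m n a a′ b b′} → suc (a + a′) ≡ m → suc (b + b′) ≡ n →
                    suc ((n * a + b) + (n * a′ + b′)) ≡ m * n
complement-digits {m} {n} {a} {a′} {b} {b′} eqa eqb = begin
  suc ((n * a + b) + (n * a′ + b′))  ≡⟨ solve (n ∷ a ∷ a′ ∷ b ∷ b′ ∷ []) ⟩
  n * (a + a′) + suc (b + b′)        ≡⟨ cong (n * (a + a′) +_) eqb ⟩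
  n * (a + a′) + n                   ≡⟨ solve (n ∷ a ∷ a′ ∷ []) ⟩
  n * suc (a + a′)                   ≡⟨ cong (n *_) eqa ⟩
  n * m                              ≡⟨ *-comm n m ⟩
  m * n                              ∎

opposite-combine : ∀ {m n} (i : Fin m) (j : Fin n) → opposite (combine i j) ≡ combine (opposite i) (opposite j)
opposite-combine {m} {n} i j = sym (complement⇒opposite (combine i j) (combine (opposite i) (opposite j)) (begin
  suc (toℕ (combine i j) + toℕ (combine (opposite i) (opposite j)))
    ≡⟨ cong₂ (λ x y → suc (x + y)) (toℕ-combine i j) (toℕ-combine (opposite i) (opposite j)) ⟩
  suc ((n * toℕ i + toℕ j) + (n * toℕ (opposite i) + toℕ (opposite j)))
    ≡⟨ complement-digits (toℕ+toℕ-opposite i) (toℕ+toℕ-opposite j) ⟩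
  m * n
    ∎))

[m+n%d]%d≡[m+n]%d : ∀ m n d .{{_ : NonZero d}} → (m + n % d) % d ≡ (m + n) % d
[m+n%d]%d≡[m+n]%d m n d = begin
  (m + n % d) % d          ≡⟨ %-distribˡ-+ m (n % d) d ⟩
  (m % d + n % d % d) % d  ≡⟨ cong (λ x → (m % d + x) % d) (m%n%n≡m%n n d) ⟩
  (m % d + n % d) % d      ≡⟨ %-distribˡ-+ m n d ⟨
  (m + n) % d              ∎

m+n≡k*d⇒m%d≡d∸n : ∀ {m n} k d .{{_ : NonZero d}} → 0 < n → n ≤ d → m + n ≡ k * d → m % d ≡ d ∸ n
m+n≡k*d⇒m%d≡d∸n {m} {suc _} zero    d _   _   eq = contradiction eq (m+1+n≢0 m)
m+n≡k*d⇒m%d≡d∸n {m} {n}     (suc k) d 0<n n≤d eq = begin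
  m % d                ≡⟨ cong (_% d) (+-cancelʳ-≡ n m (d ∸ n + k * d) m+n≡) ⟩
  (d ∸ n + k * d) % d  ≡⟨ [m+kn]%n≡m%n (d ∸ n) k d ⟩
  (d ∸ n) % d          ≡⟨ m<n⇒m%n≡m (∸-monoʳ-< 0<n n≤d) ⟩
  d ∸ n                ∎
  where
  m+n≡ : m + n ≡ d ∸ n + k * d + n
  m+n≡ = begin
    m + n                ≡⟨ eq ⟩
    d + k * d            ≡⟨ cong (_+ k * d) (m∸n+n≡m n≤d) ⟨
    d ∸ n + n + k * d    ≡⟨ +-assoc (d ∸ n) n (k * d) ⟩
    d ∸ n + (n + k * d)  ≡⟨ cong (d ∸ n +_) (+-comm n (k * d)) ⟩
    d ∸ n + (k * d + n)  ≡⟨ +-assoc (d ∸ n) (k * d) n ⟨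
    d ∸ n + k * d + n    ∎

toℕ-+ₘ : ∀ {d} .{{_ : NonZero d}} (a b : Fin d) {s} → toℕ b ≡ s % d → toℕ (a +ₘ b) ≡ (toℕ a + s) % d
toℕ-+ₘ {d} a b {s} eq = begin
  toℕ (a +ₘ b)         ≡⟨ toℕ-fromℕ< _ ⟩
  (toℕ a + toℕ b) % d  ≡⟨ cong (λ x → (toℕ a + x) % d) eq ⟩
  (toℕ a + s % d) % d  ≡⟨ [m+n%d]%d≡[m+n]%d (toℕ a) s d ⟩
  (toℕ a + s) % d      ∎

module _ (α : ℕ) where

  private
    N : ℕ
    N = 2 ^ (2 * α ∸ 1)
    instance
      N-nonZero : NonZero N
      N-nonZero = pow2-nz (2 * α ∸ 1)

  toℕ-ΣΓ₁ : ∀ n (f : Fin n → Γ α) → toℕ (proj₁ (ΣΓ α n f)) ≡ ∑[ i < n ] toℕ (proj₁ (f i)) % 2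
  toℕ-ΣΓ₁ zero    f = refl
  toℕ-ΣΓ₁ (suc n) f = toℕ-+ₘ (proj₁ (f 0F)) _ (toℕ-ΣΓ₁ n (f ∘ Fin.suc))

  toℕ-ΣΓ₂ : ∀ n (f : Fin n → Γ α) → toℕ (proj₂ (ΣΓ α n f)) ≡ ∑[ i < n ] toℕ (proj₂ (f i)) % N
  toℕ-ΣΓ₂ zero    f = trans (toℕ-fromℕ< _) (sym (m*n%n≡0 0 N))
  toℕ-ΣΓ₂ (suc n) f = toℕ-+ₘ (proj₂ (f 0F)) _ (toℕ-ΣΓ₂ n (f ∘ Fin.suc))

twist : ∀ {n} → Fin 2 → Fin 2 → Fin n → Fin n
twist 0F 0F = id
twist 0F 1F = opposite
twist 1F 0F = opposite
twist 1F 1F = id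

twist-involutive : ∀ {n} s t (x : Fin n) → twist s t (twist s t x) ≡ x
twist-involutive 0F 0F x = refl
twist-involutive 0F 1F x = opposite-involutive x
twist-involutive 1F 0F x = opposite-involutive x
twist-involutive 1F 1F x = refl

twist-complementʳ : ∀ {n} s (x : Fin n) → suc (toℕ (twist s 0F x) + toℕ (twist s 1F x)) ≡ n
twist-complementʳ 0F x = toℕ+toℕ-opposite x
twist-complementʳ 1F x = trans (cong suc (+-comm (toℕ (opposite x)) (toℕ x))) (toℕ+toℕ-opposite x)

twist-complementˡ : ∀ {n} t (x : Fin n) → suc (toℕ (twist 0F t x) + toℕ (twist 1F t x)) ≡ n
twist-complementˡ 0F x = toℕ+toℕ-opposite x
twist-complementˡ 1F x = trans (cong suc (+-comm (toℕ (opposite x)) (toℕ x))) (toℕ+toℕ-opposite x)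

twist↔ : ∀ {n} → ((Fin 2 × Fin n) × (Fin 2 × Fin n)) ↔ (Fin 2 × (Fin 2 × (Fin n × Fin n)))
twist↔ = mk↔ₛ′
  (λ ((s , p) , (t , q)) → s , t , twist s t p , twist s t q)
  (λ (s , t , p , q) → (s , twist s t p) , (t , twist s t q))
  (λ (s , t , p , q) → cong₂ (λ x y → s , t , x , y) (twist-involutive s t p) (twist-involutive s t q))
  (λ ((s , p) , (t , q)) → cong₂ (λ x y → (s , x) , (t , y)) (twist-involutive s t p) (twist-involutive s t q))

cast↔ : ∀ {m n} → m ≡ n → Fin m ↔ Fin n
cast↔ eq = mk↔ₛ′ (cast eq) (cast (sym eq)) (cast-involutive eq (sym eq)) (cast-involutive (sym eq) eq)

combine-elim : ∀ {m n} (P : Fin (m * n) → Set) → (∀ (i : Fin m) (j : Fin n) → P (combine i j)) → ∀ k → P k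
combine-elim {m} {n} P h k = subst P (combine-remQuot {m} n k) (h _ _)

module Construction (k : ℕ) where

  α h m M N : ℕ
  α = 2 + k
  h = 2 ^ k
  m = 2 ^ suc k
  M = m * m
  N = 2 ^ (2 * α ∸ 1)

  instance
    m-nonZero : NonZero m
    m-nonZero = pow2-nz (suc k)
    N-nonZero : NonZero N
    N-nonZero = pow2-nz (2 * α ∸ 1)

  2M≡N : 2 * M ≡ N
  2M≡N = begin
    2 * (m * m)              ≡⟨ cong (2 *_) (^-distribˡ-+-* 2 (suc k) (suc k)) ⟨
    2 ^ suc (suc k + suc k)  ≡⟨ cong (λ e → 2 ^ suc e) (exponent k) ⟩
    N                        ∎
    where
    exponent : ∀ k → suc k + suc k ≡ k + (suc (suc k) + 0)
    exponent = solve-∀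

  0<m : 0 < m
  0<m = m^n>0 2 (suc k)

  m≤N : m ≤ N
  m≤N = subst (m ≤_) 2M≡N (≤-trans (m≤m*n m m) (m≤m+n M (M + 0)))

  μ : Γ α
  μ = 0F , fromℕ< (∸-monoʳ-< 0<m m≤N)

  encode↔ : ((Fin 2 × Fin m) × (Fin 2 × Fin m)) ↔ Γ α
  encode↔ =
    (↔-id (Fin 2) ×-↔ (cast↔ 2M≡N ↔-∘ (↔-sym (*↔× {2} {M}) ↔-∘ (↔-id (Fin 2) ×-↔ ↔-sym (*↔× {m} {m})))))
    ↔-∘ twist↔

  square↔ : (Fin (2 * m) × Fin (2 * m)) ↔ Γ α
  square↔ = encode↔ ↔-∘ (*↔× {2} {m} ×-↔ *↔× {2} {m})

  A : Fin (2 * m) → Fin (2 * m) → Γ α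
  A i j = Inverse.to square↔ (i , j)

  A-combine : ∀ s p t q →
              A (combine s p) (combine t q) ≡ (s , cast 2M≡N (combine t (combine (twist s t p) (twist s t q))))
  A-combine s p t q = cong₂ (λ x y → Inverse.to encode↔ (x , y)) (remQuot-combine s p) (remQuot-combine t q)

  proj₁-A : ∀ s p j → proj₁ (A (combine s p) j) ≡ s
  proj₁-A s p j = cong proj₁ (remQuot-combine {2} {m} s p)

  proj₁-A-halves : ∀ p j j′ → toℕ (proj₁ (A (combine {2} 0F p) j)) + toℕ (proj₁ (A (combine {2} 1F p) j′)) ≡ 1
  proj₁-A-halves p j j′ = cong₂ _+_ (cong toℕ (proj₁-A 0F p j)) (cong toℕ (proj₁-A 1F p j′))

  value : Fin 2 → Fin m → Fin 2 → Fin m → ℕ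
  value s p t q = toℕ (proj₂ (A (combine s p) (combine t q)))

  value≡ : ∀ s p t q → value s p t q ≡ M * toℕ t + (m * toℕ (twist s t p) + toℕ (twist s t q))
  value≡ s p t q = begin
    value s p t q                                                      ≡⟨ cong (toℕ ∘ proj₂) (A-combine s p t q) ⟩
    toℕ (cast 2M≡N (combine t (combine (twist s t p) (twist s t q))))  ≡⟨ toℕ-cast 2M≡N _ ⟩
    toℕ (combine t (combine (twist s t p) (twist s t q)))              ≡⟨ toℕ-combine t _ ⟩
    M * toℕ t + toℕ (combine (twist s t p) (twist s t q))              ≡⟨ cong (M * toℕ t +_) (toℕ-combine (twist s t p) _) ⟩
    M * toℕ t + (m * toℕ (twist s t p) + toℕ (twist s t q))            ∎

  value-complement : ∀ s p t q s′ p′ t′ q′ →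
    suc (toℕ (twist s t p) + toℕ (twist s′ t′ p′)) ≡ m → suc (toℕ (twist s t q) + toℕ (twist s′ t′ q′)) ≡ m →
    suc (value s p t q + value s′ p′ t′ q′) ≡ M * (toℕ t + toℕ t′) + M
  value-complement s p t q s′ p′ t′ q′ eqp eqq = begin
    suc (value s p t q + value s′ p′ t′ q′)  ≡⟨ cong₂ (λ x y → suc (x + y)) (value≡ s p t q) (value≡ s′ p′ t′ q′) ⟩
    suc ((M * T + L) + (M * T′ + L′))        ≡⟨ regroup M T T′ L L′ ⟩
    M * (T + T′) + suc (L + L′)              ≡⟨ cong (M * (T + T′) +_) (complement-digits eqp eqq) ⟩
    M * (T + T′) + M                         ∎
    where
    T = toℕ t
    T′ = toℕ t′
    L = m * toℕ (twist s t p) + toℕ (twist s t q)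
    L′ = m * toℕ (twist s′ t′ p′) + toℕ (twist s′ t′ q′)
    regroup : ∀ a b c d e → suc ((a * b + d) + (a * c + e)) ≡ a * (b + c) + suc (d + e)
    regroup = solve-∀

  line-sum : (f : Fin (2 * m) → Γ α) (c₁ c₂ : ℕ) →
             (∀ p → halves m (toℕ ∘ proj₁ ∘ f) p ≡ c₁) →
             sum (halves m (toℕ ∘ proj₂ ∘ f)) + m ≡ c₂ * (2 * M) →
             ΣΓ α (2 * m) f ≡ μ
  line-sum f c₁ c₂ first second = cong₂ _,_
    (toℕ-injective (begin
      toℕ (proj₁ (ΣΓ α (2 * m) f))  ≡⟨ toℕ-ΣΓ₁ α (2 * m) f ⟩
      sum (toℕ ∘ proj₁ ∘ f) % 2     ≡⟨ cong (_% 2) (trans (∑-halves m _) (trans (sum-cong-≗ first) (∑-const m c₁))) ⟩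
      m * c₁ % 2                    ≡⟨ cong (_% 2) (trans (*-assoc 2 h c₁) (*-comm 2 (h * c₁))) ⟩
      h * c₁ * 2 % 2                ≡⟨ m*n%n≡0 (h * c₁) 2 ⟩
      0                             ∎))
    (toℕ-injective (begin
      toℕ (proj₂ (ΣΓ α (2 * m) f))          ≡⟨ toℕ-ΣΓ₂ α (2 * m) f ⟩
      sum (toℕ ∘ proj₂ ∘ f) % N             ≡⟨ cong (_% N) (∑-halves m _) ⟩
      sum (halves m (toℕ ∘ proj₂ ∘ f)) % N  ≡⟨ m+n≡k*d⇒m%d≡d∸n c₂ N 0<m m≤N (trans second (cong (c₂ *_) 2M≡N)) ⟩
      N ∸ m                                 ≡⟨ toℕ-fromℕ< _ ⟨
      toℕ (proj₂ μ)                         ∎))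

  row-sum : ∀ s p → ΣΓ α (2 * m) (A (combine s p)) ≡ μ
  row-sum s p = line-sum (A (combine s p)) (toℕ s + toℕ s) m
    (λ q → cong₂ _+_ (cong toℕ (proj₁-A s p (combine {2} 0F q))) (cong toℕ (proj₁-A s p (combine {2} 1F q))))
    (trans (∑+n≡n*c m _ (M * 1 + M)
             (λ q → value-complement s p 0F q s p 1F q (twist-complementʳ s p) (twist-complementʳ s q)))
           (cong (m *_) (cong₂ _+_ (*-identityʳ M) (sym (+-identityʳ M)))))

  column-sum : ∀ t q → ΣΓ α (2 * m) (λ i → A i (combine t q)) ≡ μ
  column-sum t q = line-sum (λ i → A i (combine t q)) 1 (m * toℕ t + h)
    (λ p → proj₁-A-halves p (combine t q) (combine t q))
    (trans (∑+n≡n*c m _ (M * (toℕ t + toℕ t) + M)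
             (λ p → value-complement 0F p t q 1F p t q (twist-complementˡ t p) (twist-complementˡ t q)))
           (regroup h M (toℕ t)))
    where
    regroup : ∀ a b c → (2 * a) * (b * (c + c) + b) ≡ (2 * a * c + a) * (2 * b)
    regroup = solve-∀

  diagonal : ΣΓ α (2 * m) (λ i → A i i) ≡ μ
  diagonal = line-sum (λ i → A i i) 1 m
    (λ p → proj₁-A-halves p (combine {2} 0F p) (combine {2} 1F p))
    (trans (cong (_+ m) (sum-cong-≗ pair)) (diagonal-sum m id refl))
    where
    regroup : ∀ a b → a * 0 + b + (a * 1 + b) ≡ a + 2 * b
    regroup = solve-∀
    pair : ∀ p → value 0F p 0F p + value 1F p 1F p ≡ M + 2 * (m * toℕ p + toℕ p)
    pair p = trans (cong₂ _+_ (value≡ 0F p 0F p) (value≡ 1F p 1F p)) (regroup M (m * toℕ p + toℕ p))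

  antidiagonal : ΣΓ α (2 * m) (λ i → A i (opposite i)) ≡ μ
  antidiagonal = line-sum (λ i → A i (opposite i)) 1 m
    (λ p → proj₁-A-halves p (opposite (combine {2} 0F p)) (opposite (combine {2} 1F p)))
    (trans (cong (_+ m) (sum-cong-≗ pair)) (diagonal-sum m opposite (∑-opposite m toℕ)))
    where
    regroup : ∀ a b → a * 1 + b + (a * 0 + b) ≡ a + 2 * b
    regroup = solve-∀
    value-opposite : ∀ s p → toℕ (proj₂ (A (combine s p) (opposite (combine s p)))) ≡ value s p (opposite s) (opposite p)
    value-opposite s p = cong (toℕ ∘ proj₂ ∘ A (combine s p)) (opposite-combine s p)
    pair : ∀ p → halves m (toℕ ∘ proj₂ ∘ λ i → A i (opposite i)) p ≡ M + 2 * (m * toℕ (opposite p) + toℕ p)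
    pair p = begin
      halves m (toℕ ∘ proj₂ ∘ λ i → A i (opposite i)) p
        ≡⟨ cong₂ _+_ (value-opposite 0F p) (value-opposite 1F p) ⟩
      value 0F p 1F (opposite p) + value 1F p 0F (opposite p)
        ≡⟨ cong₂ _+_ (value≡ 0F p 1F (opposite p)) (value≡ 1F p 0F (opposite p)) ⟩
      M * 1 + (m * toℕ (opposite p) + toℕ (opposite (opposite p)))
        + (M * 0 + (m * toℕ (opposite p) + toℕ (opposite (opposite p))))
        ≡⟨ cong (λ x → M * 1 + (m * toℕ (opposite p) + toℕ x) + (M * 0 + (m * toℕ (opposite p) + toℕ x)))
                (opposite-involutive p) ⟩
      M * 1 + (m * toℕ (opposite p) + toℕ p) + (M * 0 + (m * toℕ (opposite p) + toℕ p))
        ≡⟨ regroup M (m * toℕ (opposite p) + toℕ p) ⟩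
      M + 2 * (m * toℕ (opposite p) + toℕ p)
        ∎

  magicSquare : MagicSquare α (2 ^ α)
  magicSquare = record
    { A        = A
    ; bij      = Bijection.bijective (↔⇒⤖ square↔)
    ; μ        = μ
    ; rows     = combine-elim {2} {m} _ row-sum
    ; cols     = combine-elim {2} {m} _ column-sum
    ; diag     = diagonal
    ; antidiag = antidiagonal
    }

mainTheorem7 : (α : ℕ) → α ≥ 2 → MagicSquare α (2 ^ α)
mainTheorem7 (suc (suc k)) (s≤s (s≤s _)) = Construction.magicSquare k
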